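{- For every positive integer $n$ and every nonnegative integer $m$, $\mathbf{Cl}(\mathbf M_n\times\mathbf 2^m)\cong\mathbf 2^n\times\mathbf 2^m\cong\mathbf 2^{n+m}$.
   Context: For a lattice $\mathbf S$ with least element $0$, the orthogonality relation is $x\perp y$ iff $x\wedge y=0$; for $A\subseteq S$, $A^\perp:=\{x\in S\mid x\perp y\text{ for all }y\in A\}$; $A$ is closed if $A^{\perp\perp}=A$, and $\mathbf{Cl}(\mathbf S)$ is the set of closed subsets ordered by inclusion. $\mathbf M_n$ is the lattice consisting of an $n$-element antichain together with $0$ and $1$; $\mathbf 2^k$ is the Boolean algebra of all subsets of a $k$-element set; products are direct products. -}

module Defs where

open import Data.Nat using (ℕ)
open import Data.Fin using (Fin; _≟_)
open import Data.Fin.Subset using (Subset; _∩_; _⊆_) renaming (⊥ to ∅)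
open import Data.Bool using (Bool; true)
open import Data.Product using (Σ; _×_; _,_; proj₁; proj₂)
open import Relation.Binary.PropositionalEquality using (_≡_)
open import Relation.Nullary using (yes; no)

-- A meet-semilattice signature with least element (all that ⊥ needs).
record MeetZero : Set₁ where
  field
    Carrier : Set
    _∧_     : Carrier → Carrier → Carrier
    0#      : Carrier

data M (n : ℕ) : Set where
  bot  : M n
  atom : Fin n → M n
  top  : M n

meetM : ∀ {n} → M n → M n → M n
meetM bot      y        = bot
meetM top      y        = y
meetM (atom i) bot      = bot
meetM (atom i) top      = atom i
meetM (atom i) (atom j) with i ≟ j
... | yes _ = atom i
... | no  _ = bot

Mₗ : ℕ → MeetZero
Mₗ n = record { Carrier = M n ; _∧_ = meetM ; 0# = bot }

Twoₗ : ℕ → MeetZero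
Twoₗ k = record { Carrier = Subset k ; _∧_ = _∩_ ; 0# = ∅ }

_×ₗ_ : MeetZero → MeetZero → MeetZero
L ×ₗ K = record
  { Carrier = L.Carrier × K.Carrier
  ; _∧_ = λ x y → (proj₁ x L.∧ proj₁ y) , (proj₂ x K.∧ proj₂ y)
  ; 0# = L.0# , K.0# }
  where module L = MeetZero L
        module K = MeetZero K

module _ (L : MeetZero) where
  open MeetZero L

  _⊥_ : Carrier → Carrier → Set
  x ⊥ y = x ∧ y ≡ 0#

  Sub : Set
  Sub = Carrier → Bool

  _∈ₛ_ : Carrier → Sub → Set
  x ∈ₛ A = A x ≡ true

  _∈⊥_ : Carrier → (Carrier → Set) → Set
  x ∈⊥ A = ∀ y → A y → x ⊥ y

  _∈⊥⊥_ : Carrier → Sub → Set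
  x ∈⊥⊥ A = x ∈⊥ (λ y → y ∈⊥ (λ z → z ∈ₛ A))

  IsClosed : Sub → Set
  IsClosed A = ∀ x → (x ∈⊥⊥ A → x ∈ₛ A) × (x ∈ₛ A → x ∈⊥⊥ A)

  Cl : Set
  Cl = Σ Sub IsClosed

  _≤Cl_ : Cl → Cl → Set
  A ≤Cl B = ∀ x → x ∈ₛ proj₁ A → x ∈ₛ proj₁ B

  _≈Cl_ : Cl → Cl → Set
  A ≈Cl B = ∀ x → proj₁ A x ≡ proj₁ B x

record PosetData : Set₁ where
  field
    Car  : Set
    _≈_  : Car → Car → Set
    _≤_  : Car → Car → Set

ClPoset : MeetZero → PosetData
ClPoset L = record { Car = Cl L ; _≈_ = _≈Cl_ L ; _≤_ = _≤Cl_ L }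

PowPoset : ℕ → PosetData
PowPoset k = record { Car = Subset k ; _≈_ = _≡_ ; _≤_ = _⊆_ }

PowProdPoset : ℕ → ℕ → PosetData
PowProdPoset a b = record
  { Car = Subset a × Subset b
  ; _≈_ = _≡_
  ; _≤_ = λ x y → (proj₁ x ⊆ proj₁ y) × (proj₂ x ⊆ proj₂ y) }

record _≅ₒ_ (P Q : PosetData) : Set where
  module P = PosetData P
  module Q = PosetData Q
  field
    to      : P.Car → Q.Car
    from    : Q.Car → P.Car
    to∘from : ∀ y → to (from y) Q.≈ y
    from∘to : ∀ x → from (to x) P.≈ x
    mono    : ∀ x y → x P.≤ y → to x Q.≤ to y
    reflect : ∀ x y → to x Q.≤ to y → x P.≤ y

-- Map a lattice L into 2^k by a meet-homomorphism that reflects 0 and has every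
-- atom {i} in its image, say as the image of point i; call the image of x its
-- support. Then x ⊥ y just says that the supports are disjoint, so membership in
-- any A^⊥ is decided atom by atom, and a closed A consists exactly of the x whose
-- support lies in {i | point i ∈ A}. Hence Cl(L) ≅ 2^k. For M_n × 2^m take
-- k = n + m, sending top ∈ M_n to all n atoms; this reflects 0 only because n ≥ 1.
module Submission where

open import Defs
open import Data.Nat using (ℕ; _+_; _≥_; suc)
open import Data.Product using (_×_; _,_; proj₁; proj₂; uncurry)
open import Data.Sum using ([_,_]′; inj₁; inj₂)
open import Data.Bool using (Bool; true)
open import Data.Bool.Properties using (⇔→≡)
open import Data.Empty using (⊥-elim)
import Data.Fin as Fin
open import Data.Fin using (Fin; _≟_; _↑ˡ_; _↑ʳ_) renaming (zero to fzero; suc to fsuc)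
open import Data.Fin.Properties using (splitAt⁻¹-↑ˡ; splitAt⁻¹-↑ʳ)
open import Data.Fin.Subset
  using (Subset; Empty; inside; outside; _∈_; _∉_; _⊆_; _∩_; ⁅_⁆; ⊤) renaming (⊥ to ∅)
open import Data.Fin.Subset.Properties
  using ( _∈?_; _⊆?_; ⊆-antisym; Empty-unique; ∉⊥; ∈⊤; x∈⁅x⁆; x∈⁅y⁆⇒x≡y; x∈p∩q⁺; x∈p∩q⁻
        ; drop-∷-⊆; ∩-idem; ∩-identityˡ; ∩-identityʳ; ∩-zeroˡ; ∩-zeroʳ)
open import Data.Vec using (_∷_; []; _++_; splitAt; tabulate; here; there)
open import Data.Vec.Properties using (lookup∘tabulate; []=⇒lookup; lookup⇒[]=; zipWith-++; ++-injective)
open import Function using (mk⇔; _∘_)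
open import Relation.Nullary using (Dec; yes; no; does; ¬_)
open import Relation.Nullary.Decidable using (dec-true)
open import Relation.Binary.PropositionalEquality

does≡true⇒ : ∀ {P : Set} (P? : Dec P) → does P? ≡ true → P
does≡true⇒ (yes p) _ = p

module _ {k : ℕ} where

  ∈-tabulate⁺ : ∀ {f : Fin k → Bool} {i} → f i ≡ true → i ∈ tabulate f
  ∈-tabulate⁺ {f} {i} fi = lookup⇒[]= i _ (trans (lookup∘tabulate f i) fi)

  ∈-tabulate⁻ : ∀ {f : Fin k → Bool} {i} → i ∈ tabulate f → f i ≡ true
  ∈-tabulate⁻ {f} {i} i∈ = trans (sym (lookup∘tabulate f i)) ([]=⇒lookup i∈)

  ⁅⁆⊆⇒∈ : ∀ {i} {p : Subset k} → ⁅ i ⁆ ⊆ p → i ∈ p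
  ⁅⁆⊆⇒∈ {i} ⁅i⁆⊆p = ⁅i⁆⊆p (x∈⁅x⁆ i)

  ∈⇒⁅⁆⊆ : ∀ {i} {p : Subset k} → i ∈ p → ⁅ i ⁆ ⊆ p
  ∈⇒⁅⁆⊆ {i} {p} i∈p j∈⁅i⁆ = subst (_∈ p) (sym (x∈⁅y⁆⇒x≡y i j∈⁅i⁆)) i∈p

  ⁅⁆∩⁅⁆≡∅ : ∀ {i j : Fin k} → i ≢ j → ⁅ i ⁆ ∩ ⁅ j ⁆ ≡ ∅
  ⁅⁆∩⁅⁆≡∅ {i} {j} i≢j = Empty-unique λ (l , l∈) →
    let l∈⁅i⁆ , l∈⁅j⁆ = x∈p∩q⁻ ⁅ i ⁆ ⁅ j ⁆ l∈
    in i≢j (trans (sym (x∈⁅y⁆⇒x≡y i l∈⁅i⁆)) (x∈⁅y⁆⇒x≡y j l∈⁅j⁆))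

  Disjoint : Subset k → Subset k → Set
  Disjoint p q = ∀ {i} → i ∈ p → i ∉ q

  ∩≡∅⇒Disjoint : ∀ {p q : Subset k} → p ∩ q ≡ ∅ → Disjoint p q
  ∩≡∅⇒Disjoint p∩q≡∅ i∈p i∈q = ∉⊥ (subst (_ ∈_) p∩q≡∅ (x∈p∩q⁺ (i∈p , i∈q)))

  Disjoint⇒∩≡∅ : ∀ {p q : Subset k} → Disjoint p q → p ∩ q ≡ ∅
  Disjoint⇒∩≡∅ {p} {q} disjoint = Empty-unique λ (_ , i∈p∩q) →
    let i∈p , i∈q = x∈p∩q⁻ p q i∈p∩q in disjoint i∈p i∈q

  ∈⇒≢∅ : ∀ {i} {p : Subset k} → i ∈ p → p ≢ ∅
  ∈⇒≢∅ {i} i∈p p≡∅ = ∉⊥ (subst (i ∈_) p≡∅ i∈p)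

∅++∅ : ∀ a {b} → ∅ {a} ++ ∅ {b} ≡ ∅
∅++∅ 0       = refl
∅++∅ (suc a) = cong (outside ∷_) (∅++∅ a)

⁅↑ˡ⁆ : ∀ {a} (i : Fin a) b → ⁅ i ↑ˡ b ⁆ ≡ ⁅ i ⁆ ++ ∅ {b}
⁅↑ˡ⁆ {suc a} fzero     b = cong (inside ∷_) (sym (∅++∅ a))
⁅↑ˡ⁆         (fsuc i)   b = cong (outside ∷_) (⁅↑ˡ⁆ i b)

⁅↑ʳ⁆ : ∀ a {b} (j : Fin b) → ⁅ a ↑ʳ j ⁆ ≡ ∅ {a} ++ ⁅ j ⁆
⁅↑ʳ⁆ 0       j = refl
⁅↑ʳ⁆ (suc a) j = cong (outside ∷_) (⁅↑ʳ⁆ a j)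

++⁺-⊆ : ∀ {a b} {S S′ : Subset a} {T T′ : Subset b} → S ⊆ S′ → T ⊆ T′ → S ++ T ⊆ S′ ++ T′
++⁺-⊆ {S = []}    {S′ = []}    S⊆S′ T⊆T′ i∈ = T⊆T′ i∈
++⁺-⊆ {S = _ ∷ _} {S′ = _ ∷ _} S⊆S′ T⊆T′ here with S⊆S′ here
... | here = here
++⁺-⊆ {S = _ ∷ _} {S′ = _ ∷ _} S⊆S′ T⊆T′ (there i∈) = there (++⁺-⊆ (drop-∷-⊆ S⊆S′) T⊆T′ i∈)

++⁻ˡ-⊆ : ∀ {a b} {S S′ : Subset a} {T T′ : Subset b} → S ++ T ⊆ S′ ++ T′ → S ⊆ S′
++⁻ˡ-⊆ {S = _ ∷ _} {S′ = _ ∷ _} ⊆′ here with ⊆′ here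
... | here = here
++⁻ˡ-⊆ {S = _ ∷ _} {S′ = _ ∷ _} ⊆′ (there i∈) = there (++⁻ˡ-⊆ (drop-∷-⊆ ⊆′) i∈)

++⁻ʳ-⊆ : ∀ {a b} {S S′ : Subset a} {T T′ : Subset b} → S ++ T ⊆ S′ ++ T′ → T ⊆ T′
++⁻ʳ-⊆ {S = []}    {S′ = []}    ⊆′ = ⊆′
++⁻ʳ-⊆ {S = _ ∷ _} {S′ = _ ∷ _} ⊆′ = ++⁻ʳ-⊆ (drop-∷-⊆ ⊆′)

++-≅ₒ : ∀ a b → PowProdPoset a b ≅ₒ PowPoset (a + b)
++-≅ₒ a b = record
  { to      = λ (S , T) → S ++ T
  ; from    = λ U → let S , T , _ = splitAt a U in S , T
  ; to∘from = λ U → let _ , _ , U≡S++T = splitAt a U in sym U≡S++T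
  ; from∘to = λ (S , T) → let _ , _ , S++T≡ = splitAt a (S ++ T)
                          in sym (uncurry (cong₂ _,_) (++-injective S _ S++T≡))
  ; mono    = λ _ _ (S⊆S′ , T⊆T′) → ++⁺-⊆ S⊆S′ T⊆T′
  ; reflect = λ _ _ ⊆′ → ++⁻ˡ-⊆ ⊆′ , ++⁻ʳ-⊆ ⊆′
  }

≅ₒ-viaPow : ∀ {P R k} → P ≅ₒ PowPoset k → R ≅ₒ PowPoset k → P ≅ₒ R
≅ₒ-viaPow {P} {R} P≅ R≅ = record
  { to      = R.from ∘ P.to
  ; from    = P.from ∘ R.to
  ; to∘from = λ r → subst (λ U → R.from U R≈ r) (sym (P.to∘from (R.to r))) (R.from∘to r)
  ; from∘to = λ p → subst (λ U → P.from U P≈ p) (sym (R.to∘from (P.to p))) (P.from∘to p)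
  ; mono    = λ x y x≤y → R.reflect _ _ (subst₂ _⊆_ (sym (R.to∘from _)) (sym (R.to∘from _)) (P.mono x y x≤y))
  ; reflect = λ x y ≤′ → P.reflect x y (subst₂ _⊆_ (R.to∘from _) (R.to∘from _) (R.mono _ _ ≤′))
  }
  where
  module P = _≅ₒ_ P≅
  module R = _≅ₒ_ R≅
  open PosetData P renaming (_≈_ to _P≈_)
  open PosetData R renaming (_≈_ to _R≈_)

record SupportMap (L : MeetZero) (k : ℕ) : Set where
  open MeetZero L
  field
    supp         : Carrier → Subset k
    supp-∧       : ∀ x y → supp (x ∧ y) ≡ supp x ∩ supp y
    supp-0#      : supp 0# ≡ ∅
    supp≡∅⇒≡0#   : ∀ {x} → supp x ≡ ∅ → x ≡ 0#
    point        : Fin k → Carrier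
    supp-point   : ∀ i → supp (point i) ≡ ⁅ i ⁆

module _ {L : MeetZero} {k : ℕ} (S : SupportMap L k) where
  open MeetZero L
  open SupportMap S

  private
    _⟂_ : Carrier → Carrier → Set
    _⟂_ = _⊥_ L

    _∈⊥ᴸ_ : Carrier → (Carrier → Set) → Set
    _∈⊥ᴸ_ = _∈⊥_ L

    _∈⊥⊥ᴸ_ : Carrier → Sub L → Set
    _∈⊥⊥ᴸ_ = _∈⊥⊥_ L

  ⟂⇒Disjoint : ∀ {x y} → x ⟂ y → Disjoint (supp x) (supp y)
  ⟂⇒Disjoint {x} {y} x∧y≡0 = ∩≡∅⇒Disjoint (begin
    supp x ∩ supp y ≡⟨ supp-∧ x y ⟨
    supp (x ∧ y)    ≡⟨ cong supp x∧y≡0 ⟩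
    supp 0#         ≡⟨ supp-0# ⟩
    ∅               ∎)
    where open ≡-Reasoning

  Disjoint⇒⟂ : ∀ {x y} → Disjoint (supp x) (supp y) → x ⟂ y
  Disjoint⇒⟂ {x} {y} disjoint = supp≡∅⇒≡0# (trans (supp-∧ x y) (Disjoint⇒∩≡∅ disjoint))

  ⟂-sym : ∀ {x y} → x ⟂ y → y ⟂ x
  ⟂-sym x⟂y = Disjoint⇒⟂ λ i∈y i∈x → ⟂⇒Disjoint x⟂y i∈x i∈y

  ∈-supp-point : ∀ i → i ∈ supp (point i)
  ∈-supp-point i = subst (i ∈_) (sym (supp-point i)) (x∈⁅x⁆ i)

  point-⟂⇒∉ : ∀ {i y} → point i ⟂ y → i ∉ supp y
  point-⟂⇒∉ {i} i⟂y = ⟂⇒Disjoint i⟂y (∈-supp-point i)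

  ∉⇒point-⟂ : ∀ {i y} → i ∉ supp y → point i ⟂ y
  ∉⇒point-⟂ {i} {y} i∉y = Disjoint⇒⟂ λ j∈i →
    subst (_∉ supp y) (sym (x∈⁅y⁆⇒x≡y i (subst (_ ∈_) (supp-point i) j∈i))) i∉y

  ¬point-⟂-self : ∀ i → ¬ point i ⟂ point i
  ¬point-⟂-self i i⟂i = point-⟂⇒∉ i⟂i (∈-supp-point i)

  ∈⊥⇒point-∈⊥ : ∀ {P x i} → x ∈⊥ᴸ P → i ∈ supp x → point i ∈⊥ᴸ P
  ∈⊥⇒point-∈⊥ x∈⊥ i∈x y Py = ∉⇒point-⟂ (⟂⇒Disjoint (x∈⊥ y Py) i∈x)

  points-∈⊥⇒∈⊥ : ∀ {P x} → (∀ {i} → i ∈ supp x → point i ∈⊥ᴸ P) → x ∈⊥ᴸ P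
  points-∈⊥⇒∈⊥ points-∈⊥ y Py = Disjoint⇒⟂ λ i∈x i∈y → point-⟂⇒∉ (points-∈⊥ i∈x y Py) i∈y

  ∈⇒∈⊥⊥ : ∀ {A : Sub L} {x} → A x ≡ true → x ∈⊥⊥ᴸ A
  ∈⇒∈⊥⊥ {x = x} x∈A y y∈⊥ = ⟂-sym (y∈⊥ x x∈A)

  trace : Sub L → Subset k
  trace A = tabulate (λ i → A (point i))

  ∈closed⇒supp⊆trace : ∀ {A x} → IsClosed L A → A x ≡ true → supp x ⊆ trace A
  ∈closed⇒supp⊆trace {A} {x} closed x∈A {i} i∈x =
    ∈-tabulate⁺ (proj₁ (closed (point i)) (∈⊥⇒point-∈⊥ (proj₂ (closed x) x∈A) i∈x))

  supp⊆trace⇒∈closed : ∀ {A x} → IsClosed L A → supp x ⊆ trace A → A x ≡ true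
  supp⊆trace⇒∈closed {A} {x} closed supp⊆trace = proj₁ (closed x) (points-∈⊥⇒∈⊥ λ {i} i∈x →
    proj₂ (closed (point i)) (∈-tabulate⁻ (supp⊆trace i∈x)))

  Down : Subset k → Sub L
  Down χ x = does (supp x ⊆? χ)

  Down⇒⊆ : ∀ {χ x} → Down χ x ≡ true → supp x ⊆ χ
  Down⇒⊆ {χ} {x} = does≡true⇒ (supp x ⊆? χ)

  ⊆⇒Down : ∀ {χ x} → supp x ⊆ χ → Down χ x ≡ true
  ⊆⇒Down {χ} {x} = dec-true (supp x ⊆? χ)

  point-∈⊥⊥-Down⇒∈ : ∀ {χ i} → point i ∈⊥⊥ᴸ (Down χ) → i ∈ χ
  point-∈⊥⊥-Down⇒∈ {χ} {i} point∈⊥⊥ with i ∈? χ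
  ... | yes i∈χ = i∈χ
  ... | no  i∉χ = ⊥-elim (¬point-⟂-self i (point∈⊥⊥ (point i) point∈⊥))
    where
    point∈⊥ : point i ∈⊥ᴸ (λ y → Down χ y ≡ true)
    point∈⊥ y y∈Down = ∉⇒point-⟂ (i∉χ ∘ Down⇒⊆ y∈Down)

  Down-closed : ∀ χ → IsClosed L (Down χ)
  Down-closed χ x =
    (λ x∈⊥⊥ → ⊆⇒Down λ i∈x → point-∈⊥⊥-Down⇒∈ (∈⊥⇒point-∈⊥ x∈⊥⊥ i∈x)) , ∈⇒∈⊥⊥

  trace-Down : ∀ χ → trace (Down χ) ≡ χ
  trace-Down χ = ⊆-antisym
    (λ {i} i∈ → ⁅⁆⊆⇒∈ (subst (_⊆ χ) (supp-point i) (Down⇒⊆ (∈-tabulate⁻ i∈))))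
    (λ {i} i∈χ → ∈-tabulate⁺ (⊆⇒Down (subst (_⊆ χ) (sym (supp-point i)) (∈⇒⁅⁆⊆ i∈χ))))

  Down-trace : ∀ {A} → IsClosed L A → ∀ x → Down (trace A) x ≡ A x
  Down-trace closed x =
    ⇔→≡ (mk⇔ (supp⊆trace⇒∈closed closed ∘ Down⇒⊆) (⊆⇒Down ∘ ∈closed⇒supp⊆trace closed))

  Cl≅ₒPow : ClPoset L ≅ₒ PowPoset k
  Cl≅ₒPow = record
    { to      = trace ∘ proj₁
    ; from    = λ χ → Down χ , Down-closed χ
    ; to∘from = trace-Down
    ; from∘to = λ (_ , closed) → Down-trace closed
    ; mono    = λ _ _ A⊆B i∈ → ∈-tabulate⁺ (A⊆B _ (∈-tabulate⁻ i∈))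
    ; reflect = λ (_ , A-closed) (_ , B-closed) trA⊆trB x x∈A →
        supp⊆trace⇒∈closed B-closed (trA⊆trB ∘ ∈closed⇒supp⊆trace A-closed x∈A)
    }

suppM : ∀ {n} → M n → Subset n
suppM bot      = ∅
suppM (atom i) = ⁅ i ⁆
suppM top      = ⊤

suppM-meet : ∀ {n} (a b : M n) → suppM (meetM a b) ≡ suppM a ∩ suppM b
suppM-meet bot      b        = sym (∩-zeroˡ (suppM b))
suppM-meet top      b        = sym (∩-identityˡ (suppM b))
suppM-meet (atom i) bot      = sym (∩-zeroʳ ⁅ i ⁆)
suppM-meet (atom i) top      = sym (∩-identityʳ ⁅ i ⁆)
suppM-meet (atom i) (atom j) with i ≟ j
... | yes refl = sym (∩-idem ⁅ i ⁆)
... | no  i≢j  = sym (⁅⁆∩⁅⁆≡∅ i≢j)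

suppM≡∅⇒≡bot : ∀ {n} (a : M (suc n)) → suppM a ≡ ∅ → a ≡ bot
suppM≡∅⇒≡bot bot      _     = refl
suppM≡∅⇒≡bot (atom i) ⁅i⁆≡∅ = ⊥-elim (∈⇒≢∅ (x∈⁅x⁆ i) ⁅i⁆≡∅)
suppM≡∅⇒≡bot top      ⊤≡∅   = ⊥-elim (∈⇒≢∅ (∈⊤ {x = fzero}) ⊤≡∅)

M-support : ∀ n → SupportMap (Mₗ (suc n)) (suc n)
M-support n = record
  { supp       = suppM
  ; supp-∧     = suppM-meet
  ; supp-0#    = refl
  ; supp≡∅⇒≡0# = suppM≡∅⇒≡bot _
  ; point      = atom
  ; supp-point = λ _ → refl
  }

Two-support : ∀ m → SupportMap (Twoₗ m) m
Two-support m = record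
  { supp       = λ p → p
  ; supp-∧     = λ _ _ → refl
  ; supp-0#    = refl
  ; supp≡∅⇒≡0# = λ p≡∅ → p≡∅
  ; point      = ⁅_⁆
  ; supp-point = λ _ → refl
  }

_×-support_ : ∀ {L K a b} → SupportMap L a → SupportMap K b → SupportMap (L ×ₗ K) (a + b)
_×-support_ {L} {K} {a} {b} S T = record
  { supp       = λ (x , y) → S.supp x ++ T.supp y
  ; supp-∧     = λ (x , y) (x′ , y′) → begin
      S.supp (x L.∧ x′) ++ T.supp (y K.∧ y′)               ≡⟨ cong₂ _++_ (S.supp-∧ x x′) (T.supp-∧ y y′) ⟩
      (S.supp x ∩ S.supp x′) ++ (T.supp y ∩ T.supp y′)     ≡⟨ zipWith-++ _ (S.supp x) (T.supp y) (S.supp x′) (T.supp y′) ⟨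
      (S.supp x ++ T.supp y) ∩ (S.supp x′ ++ T.supp y′)    ∎
  ; supp-0#    = trans (cong₂ _++_ S.supp-0# T.supp-0#) (∅++∅ a)
  ; supp≡∅⇒≡0# = λ {(x , y)} supp≡∅ →
      let x≡∅ , y≡∅ = ++-injective (S.supp x) ∅ (trans supp≡∅ (sym (∅++∅ a)))
      in cong₂ _,_ (S.supp≡∅⇒≡0# x≡∅) (T.supp≡∅⇒≡0# y≡∅)
  ; point      = point
  ; supp-point = supp-point
  }
  where
  module S = SupportMap S
  module T = SupportMap T
  module L = MeetZero L
  module K = MeetZero K
  open ≡-Reasoning

  point : Fin (a + b) → MeetZero.Carrier (L ×ₗ K)
  point i = [ (λ i → S.point i , K.0#) , (λ j → L.0# , T.point j) ]′ (Fin.splitAt a i)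

  supp-point : ∀ i → S.supp (proj₁ (point i)) ++ T.supp (proj₂ (point i)) ≡ ⁅ i ⁆
  supp-point i with Fin.splitAt a i in split≡
  ... | inj₁ i′ = begin
    S.supp (S.point i′) ++ T.supp K.0#  ≡⟨ cong₂ _++_ (S.supp-point i′) T.supp-0# ⟩
    ⁅ i′ ⁆ ++ ∅                          ≡⟨ ⁅↑ˡ⁆ i′ b ⟨
    ⁅ i′ ↑ˡ b ⁆                          ≡⟨ cong ⁅_⁆ (splitAt⁻¹-↑ˡ split≡) ⟩
    ⁅ i ⁆                                ∎
  ... | inj₂ j = begin
    S.supp L.0# ++ T.supp (T.point j)    ≡⟨ cong₂ _++_ S.supp-0# (T.supp-point j) ⟩
    ∅ ++ ⁅ j ⁆                           ≡⟨ ⁅↑ʳ⁆ a j ⟨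
    ⁅ a ↑ʳ j ⁆                           ≡⟨ cong ⁅_⁆ (splitAt⁻¹-↑ʳ split≡) ⟩
    ⁅ i ⁆                                ∎

corollary2 : (n m : ℕ) → n ≥ 1 →
    (ClPoset (Mₗ n ×ₗ Twoₗ m) ≅ₒ PowProdPoset n m) × (PowProdPoset n m ≅ₒ PowPoset (n + m))
corollary2 (suc n) m _ =
  ≅ₒ-viaPow (Cl≅ₒPow (M-support n ×-support Two-support m)) (++-≅ₒ (suc n) m) , ++-≅ₒ (suc n) m
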